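{- Let $\vec\kappa=\langle\kappa_0\le\dots\le\kappa_n\rangle$ be a weakly increasing tuple of cardinals, $0\le k\le n$, $B\in[n+1]^{k+1}$, and let $\vec f=(f_A)_{A\in[n+1]^{k+1}}$ be a $k$-cocycle for $\vec\kappa$. Define $\phi_{\vec f,B}:X(\vec\kappa^B)\to Z^k(\vec\kappa|_B)$ by $\phi_{\vec f,B}(\vec x)(\vec y)=f_B(\vec x,\vec y)$ for $\vec x\in X(\vec\kappa^B)$ and $\vec y\in\prod_{i\in B}\kappa_i$. Then $\phi_{\vec f,B}$ is continuous, and for every $\vec x\in X(\vec\kappa^B)$ other than $(\infty,\dots,\infty)$, $\phi_{\vec f,B}(\vec x)$ is a top coboundary for $\vec\kappa|_B$.
   Context: For a cardinal $\kappa$, $\alpha(\kappa)=\kappa\sqcup\{\infty\}$ is the one-point compactification of the discrete space $\kappa$. For a tuple $\vec\mu=\langle\mu_0,\dots,\mu_m\rangle$, $X(\vec\mu)=\prod_{i\le m}\alpha(\mu_i)$ (product topology); for $A\subseteq\{0,\dots,m\}$, $\mathcal{D}_A(\vec\mu)=\{\vec x\in X(\vec\mu):x_i\neq\infty\ \forall i\in A\}$ and $\mathcal{C}_A(\vec\mu)$ is the set of continuous maps $\mathcal{D}_A(\vec\mu)\to\mathbb{Z}_2$ ($\mathbb{Z}_2$ discrete). $[n+1]^j$ denotes the $j$-element subsets of $\{0,\dots,n\}$. A $k$-cochain for $\vec\kappa$ is $\vec f=(f_A)_{A\in[n+1]^{k+1}}$ with $f_A\in\mathcal{C}_A(\vec\kappa)$;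 it is a cocycle if $\sum_{i\in A'}f_{A'\setminus\{i\}}=0$ on $\mathcal{D}_{A'}(\vec\kappa)$ for all $A'\in[n+1]^{k+2}$. For $B\subseteq\{0,\dots,n\}$, $\vec\kappa|_B=\langle\kappa_i:i\in B\rangle$, $\vec\kappa^B=\langle\kappa_i:i\notin B\rangle$, and $(\vec x,\vec y)$ denotes the point of $X(\vec\kappa)$ with coordinates $\vec x$ outside $B$ and $\vec y$ in $B$. $Z^k(\vec\kappa|_B)$ is the set of all functions $\prod_{i\in B}\kappa_i\to\mathbb{Z}_2$, with the product (pointwise convergence) topology of discrete $\mathbb{Z}_2$'s. Such a function $h$ is a top coboundary for $\vec\kappa|_B$ if $h=\sum_{i\in B}g_i|_{\prod_{j\in B}\kappa_j}$ for some continuous $g_i:\mathcal{D}_{B\setminus\{i\}}(\vec\kappa|_B)\to\mathbb{Z}_2$ (indexing coordinates of $\vec\kappa|_B$ by $B$). -}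

module Defs where

open import Data.Nat using (ℕ; zero; suc)
open import Data.Fin using (Fin)
open import Data.Fin.Subset using (Subset; _-_)
open import Data.Vec using (lookup)
open import Data.Bool using (Bool; true; false; _xor_; not; if_then_else_)
open import Data.Maybe using (Maybe; just; nothing)
open import Data.Unit using (tt) renaming (⊤ to Unit)
open import Data.List using (List)
open import Data.List.Membership.Propositional using (_∈_)
open import Data.List.Relation.Unary.All using (All)
open import Data.Product using (Σ; ∃; _×_; _,_; proj₁)
open import Relation.Binary.PropositionalEquality using (_≡_)
open import Relation.Nullary using (¬_)

-- Finite XOR-sum (addition in Z₂ = Bool with xor) over all of Fin m.
⊕ : ∀ {m} → (Fin m → Bool) → Bool
⊕ {zero}  g = false
⊕ {suc m} g = g Fin.zero xor ⊕ (λ i → g (Fin.suc i))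

⊕[_] : ∀ {m} → Subset m → (Fin m → Bool) → Bool
⊕[ A ] g = ⊕ (λ i → if lookup A i then g i else false)

-- A coordinate of a point: present coordinates live in α(K) = Maybe K
-- (nothing = ∞); absent coordinates are a dummy one-point factor.
Coord : Bool → Set → Set
Coord true  K = Maybe K
Coord false K = Unit

inf : ∀ {K} (b : Bool) → Coord b K
inf true  = nothing
inf false = tt

module _ {N : ℕ} (κ : Fin N → Set) where

  -- Points of the product ∏_{i, p i = true} α(κ i)  (p selects the coordinates).
  Pt : (Fin N → Bool) → Set
  Pt p = (i : Fin N) → Coord (p i) (κ i)

  ∞pt : (p : Fin N → Bool) → Pt p
  ∞pt p i = inf (p i)

  IsFinite : ∀ {K} (b : Bool) → Coord b K → Set
  IsFinite true  m = ∃ λ a → m ≡ just a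
  IsFinite false _ = Unit

  InD : (p : Fin N → Bool) → Subset N → Pt p → Set
  InD p A x = ∀ i → lookup A i ≡ true → IsFinite (p i) (x i)

  -- Basic open neighbourhoods in the product topology: at a coordinate x_i = a ≠ ∞
  -- the neighbourhood is {a}; at x_i = ∞ it is α(κ_i) minus a finite set F_i.
  NearC : ∀ {K} (b : Bool) → Coord b K → List K → Coord b K → Set
  NearC true  (just a) F m        = m ≡ just a
  NearC true  nothing  F nothing  = Unit
  NearC true  nothing  F (just c) = ¬ (c ∈ F)
  NearC false _        F _        = Unit

  Near : (p : Fin N → Bool) → Pt p → ((i : Fin N) → List (κ i)) → Pt p → Set
  Near p x F y = ∀ i → NearC (p i) (x i) (F i) (y i)

  -- f restricted to the subspace D_A of the product is continuous into discrete Z₂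
  Continuous : (p : Fin N → Bool) → Subset N → (Pt p → Bool) → Set
  Continuous p A f =
    ∀ x → InD p A x →
      Σ ((i : Fin N) → List (κ i)) λ F →
        ∀ y → InD p A y → Near p x F y → f y ≡ f x

  full : Fin N → Bool
  full _ = true

  -- a k-cochain: for each A ∈ [N]^{k+1}, f A is continuous on D_A(κ)
  -- (the family is indexed by all subsets; entries for other sizes are never used)
  IsCochain : ℕ → (Subset N → Pt full → Bool) → Set
  IsCochain k f = ∀ A → Data.Fin.Subset.∣ A ∣ ≡ suc k → Continuous full A (f A)

  IsCocycle : ℕ → (Subset N → Pt full → Bool) → Set
  IsCocycle k f =
    ∀ A′ → Data.Fin.Subset.∣ A′ ∣ ≡ suc (suc k) →
      ∀ z → InD full A′ z → ⊕[ A′ ] (λ i → f (A′ - i) z) ≡ false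

  module _ (B : Subset N) where

    inB outB : Fin N → Bool
    inB i = lookup B i
    outB i = not (lookup B i)

    merge : ∀ {K} (b : Bool) → Coord (not b) K → Coord b K → Maybe K
    merge true  _ m = m
    merge false m _ = m

    pair : Pt outB → Pt inB → Pt full
    pair x y i = merge (lookup B i) (x i) (y i)

    -- ∏_{i∈B} κ_i as the subspace D_B of X(κ|_B)
    PtProdB : Set
    PtProdB = Σ (Pt inB) (InD inB B)

    -- φ_{f,B}(x)(y) = f_B(x,y); an element of Z^k(κ|_B) is represented by a function
    -- on Pt inB whose values are only ever inspected on PtProdB.
    φ : (Subset N → Pt full → Bool) → Pt outB → Pt inB → Bool
    φ f x y = f B (pair x y)

    -- continuity of X(κ^B) → Z^k(κ|_B) (pointwise-convergence topology):
    -- for each x and each basic neighbourhood of φ(x) (fixing finitely many values)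
    -- there is a basic neighbourhood of x mapped into it.
    ContinuousZ : (Pt outB → Pt inB → Bool) → Set
    ContinuousZ Φ =
      ∀ x (S : List PtProdB) →
        Σ ((i : Fin N) → List (κ i)) λ F →
          ∀ x′ → Near outB x F x′ → All (λ y → Φ x′ (proj₁ y) ≡ Φ x (proj₁ y)) S

    TopCoboundary : (Pt inB → Bool) → Set
    TopCoboundary h =
      Σ (Fin N → Pt inB → Bool) λ g →
        (∀ i → lookup B i ≡ true → Continuous inB (B - i) (g i)) ×
        (∀ y → InD inB B y → h y ≡ ⊕[ B ] (λ i → g i y))

{-# OPTIONS --safe #-}
-- If some coordinate x_j (j ∉ B) of x is finite, put A′ = B ∪ {j}.  The cocycle identity
-- on A′ at (x, y) writes f_B(x, y) as Σ_{i ∈ B} f_{A′∖{i}}(x, y), and with x fixed each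
-- summand is continuous on D_{B∖{i}}(κ|_B), because the only coordinate of A′∖{i} outside
-- B is j, where x is finite.  Continuity of φ is continuity of f_B at the finitely many
-- points (x, y) that a basic neighbourhood in Z^k(κ|_B) constrains.
module Submission where

open import Defs
open import Data.Nat using (ℕ; suc; _≤_)
open import Data.Fin using (Fin)
open import Data.Fin.Subset using (Subset; ∣_∣)
open import Data.Bool using (Bool)
open import Data.Product using (_×_)
open import Relation.Binary.PropositionalEquality using (_≡_)
open import Relation.Nullary using (¬_)
open import Function.Bundles using (_↣_)

open import Data.Nat.Properties using (suc-injective)
open import Data.Fin using (zero; suc; _≟_)
open import Data.Fin.Properties using (¬∀⟶∃¬)
open import Data.Fin.Subset using (_-_; ⁅_⁆)
open import Data.Fin.Subset.Properties using (p─⊥≡p; p─q⊆p)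
open import Data.Vec using (lookup; _∷_; _[_]≔_)
open import Data.Vec.Properties
  using (lookup∘update; lookup∘update′; []≔-idempotent; []≔-commutes; []≔-lookup; []=⇒lookup; lookup⇒[]=)
open import Data.Bool using (true; false; not; _xor_; if_then_else_)
open import Data.Maybe using (Maybe; just; nothing)
open import Data.Unit using (tt)
open import Data.List using (List; []; _∷_; _++_)
open import Data.List.Relation.Binary.Subset.Propositional using (_⊆_)
open import Data.List.Relation.Binary.Subset.Propositional.Properties using (xs⊆xs++ys; xs⊆ys++xs)
open import Data.List.Relation.Unary.All using ([]; _∷_)
open import Data.Product using (∃; _,_)
open import Function using (_∘_)
open import Relation.Binary.PropositionalEquality using (refl; sym; trans; cong; subst; _≢_; module ≡-Reasoning)
open import Relation.Nullary using (Dec; yes; no; contradiction)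

xor-swap : ∀ a b c → a xor (b xor c) ≡ b xor (a xor c)
xor-swap false false c = refl
xor-swap false true  c = refl
xor-swap true  false c = refl
xor-swap true  true  c = refl

xor≡false⇒≡ : ∀ {a b} → a xor b ≡ false → a ≡ b
xor≡false⇒≡ {false} {false} _ = refl
xor≡false⇒≡ {true}  {true}  _ = refl

p-x≡p[x]≔false : ∀ {m} (p : Subset m) x → p - x ≡ p [ x ]≔ false
p-x≡p[x]≔false (b ∷ p) zero    = cong (false ∷_) (p─⊥≡p p)
p-x≡p[x]≔false (b ∷ p) (suc x) = cong (b ∷_) (p-x≡p[x]≔false p x)

p-x⊆p : ∀ {m} (p : Subset m) x y → lookup (p - x) y ≡ true → lookup p y ≡ true
p-x⊆p p x y y∈p-x = []=⇒lookup (p─q⊆p p ⁅ x ⁆ (lookup⇒[]= y (p - x) y∈p-x))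

x∈p⇒suc∣p-x∣≡∣p∣ : ∀ {m} (p : Subset m) x → lookup p x ≡ true → suc ∣ p - x ∣ ≡ ∣ p ∣
x∈p⇒suc∣p-x∣≡∣p∣ (true  ∷ p) zero    refl = cong (suc ∘ ∣_∣) (p─⊥≡p p)
x∈p⇒suc∣p-x∣≡∣p∣ (true  ∷ p) (suc x) x∈p  = cong suc (x∈p⇒suc∣p-x∣≡∣p∣ p x x∈p)
x∈p⇒suc∣p-x∣≡∣p∣ (false ∷ p) (suc x) x∈p  = x∈p⇒suc∣p-x∣≡∣p∣ p x x∈p

x∈p⇒⊕[p]≡g[x]xor⊕[p-x] : ∀ {m} (p : Subset m) x (g : Fin m → Bool) →
  lookup p x ≡ true → ⊕[ p ] g ≡ g x xor ⊕[ p - x ] g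
x∈p⇒⊕[p]≡g[x]xor⊕[p-x] (true ∷ p) zero g refl =
  cong (λ q → g zero xor ⊕[ q ] (g ∘ suc)) (sym (p─⊥≡p p))
x∈p⇒⊕[p]≡g[x]xor⊕[p-x] (b ∷ p) (suc x) g x∈p = begin
  g₀ xor ⊕[ p ] (g ∘ suc)
    ≡⟨ cong (g₀ xor_) (x∈p⇒⊕[p]≡g[x]xor⊕[p-x] p x (g ∘ suc) x∈p) ⟩
  g₀ xor (g (suc x) xor ⊕[ p - x ] (g ∘ suc))
    ≡⟨ xor-swap g₀ (g (suc x)) _ ⟩
  g (suc x) xor (g₀ xor ⊕[ p - x ] (g ∘ suc))
    ∎
  where
  open ≡-Reasoning
  g₀ = if b then g zero else false

x∉p⇒p[x]≔true-x≡p : ∀ {m} (p : Subset m) x → lookup p x ≡ false → (p [ x ]≔ true) - x ≡ p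
x∉p⇒p[x]≔true-x≡p p x x∉p = begin
  (p [ x ]≔ true) - x          ≡⟨ p-x≡p[x]≔false (p [ x ]≔ true) x ⟩
  (p [ x ]≔ true) [ x ]≔ false ≡⟨ []≔-idempotent p x ⟩
  p [ x ]≔ false               ≡⟨ cong (p [ x ]≔_) (sym x∉p) ⟩
  p [ x ]≔ lookup p x          ≡⟨ []≔-lookup p x ⟩
  p                            ∎
  where open ≡-Reasoning

p[y]≔true-x≡p-x[y]≔true : ∀ {m} (p : Subset m) {x y} →
  x ≢ y → (p [ y ]≔ true) - x ≡ (p - x) [ y ]≔ true
p[y]≔true-x≡p-x[y]≔true p {x} {y} x≢y = begin
  (p [ y ]≔ true) - x           ≡⟨ p-x≡p[x]≔false (p [ y ]≔ true) x ⟩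
  (p [ y ]≔ true) [ x ]≔ false  ≡⟨ []≔-commutes p y x (x≢y ∘ sym) ⟩
  (p [ x ]≔ false) [ y ]≔ true  ≡⟨ cong (_[ y ]≔ true) (sym (p-x≡p[x]≔false p x)) ⟩
  (p - x) [ y ]≔ true           ∎
  where open ≡-Reasoning

module Slices {N : ℕ} (κ : Fin N → Set) (B : Subset N) where

  private
    X Y Z : Set
    X = Pt κ (outB κ B)
    Y = Pt κ (inB κ B)
    Z = Pt κ (full κ)

  ≡inf? : ∀ {K} b (c : Coord b K) → Dec (c ≡ inf b)
  ≡inf? true  nothing  = yes refl
  ≡inf? true  (just a) = no λ ()
  ≡inf? false tt       = yes refl

  ≢inf⇒outside-finite : ∀ {K} b (c : Coord (not b) K) →
    c ≢ inf (not b) → b ≡ false × IsFinite κ (not b) c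
  ≢inf⇒outside-finite true  tt       c≢∞ = contradiction refl c≢∞
  ≢inf⇒outside-finite false nothing  c≢∞ = contradiction refl c≢∞
  ≢inf⇒outside-finite false (just a) c≢∞ = refl , a , refl

  finite-outside-coordinate : ∀ (x : X) → ¬ (∀ i → x i ≡ ∞pt κ (outB κ B) i) →
    ∃ λ j → lookup B j ≡ false × IsFinite κ (outB κ B j) (x j)
  finite-outside-coordinate x x≢∞ with ¬∀⟶∃¬ N _ (λ i → ≡inf? _ (x i)) x≢∞
  ... | j , xj≢∞ = j , ≢inf⇒outside-finite (lookup B j) (x j) xj≢∞

  merge-finiteʳ : ∀ {K} b (u : Coord (not b) K) v →
    b ≡ true → IsFinite κ b v → IsFinite κ true (merge κ B b u v)
  merge-finiteʳ true u v refl v-fin = v-fin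

  merge-finiteˡ : ∀ {K} b (u : Coord (not b) K) v →
    b ≡ false → IsFinite κ (not b) u → IsFinite κ true (merge κ B b u v)
  merge-finiteˡ false u v refl u-fin = u-fin

  pair-InD : ∀ C (x : X) (y : Y) → (∀ l → lookup C l ≡ true → lookup B l ≡ true) →
    InD κ (inB κ B) C y → InD κ (full κ) C (pair κ B x y)
  pair-InD C x y C⊆B y∈D l l∈C = merge-finiteʳ (lookup B l) (x l) (y l) (C⊆B l l∈C) (y∈D l l∈C)

  InD-insert : ∀ C (z : Z) j →
    IsFinite κ true (z j) → InD κ (full κ) C z → InD κ (full κ) (C [ j ]≔ true) z
  InD-insert C z j zj-fin z∈D l l∈C′ with l ≟ j
  ... | yes refl = zj-fin
  ... | no  l≢j  = z∈D l (trans (sym (lookup∘update′ l≢j C true)) l∈C′)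

  NearC-antitone : ∀ {K} b (c : Coord b K) {F G : List K} →
    F ⊆ G → ∀ {c′} → NearC κ b c G c′ → NearC κ b c F c′
  NearC-antitone true  (just a) _   near = near
  NearC-antitone true  nothing  _   {nothing} _ = tt
  NearC-antitone true  nothing  F⊆G {just c}  c∉G = c∉G ∘ F⊆G
  NearC-antitone false _        _   _ = tt

  Near-antitone : ∀ {p} (z : Pt κ p) {F G : (i : Fin N) → List (κ i)} → (∀ i → F i ⊆ G i) →
    ∀ {z′} → Near κ p z G z′ → Near κ p z F z′
  Near-antitone {p} z F⊆G near i = NearC-antitone (p i) (z i) (F⊆G i) (near i)

  NearC-refl : ∀ {K} (c : Maybe K) F → NearC κ true c F c
  NearC-refl (just a) F = refl
  NearC-refl nothing  F = tt

  NearC-mergeˡ : ∀ {K} b (u u′ : Coord (not b) K) v {F} →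
    NearC κ (not b) u F u′ → NearC κ true (merge κ B b u v) F (merge κ B b u′ v)
  NearC-mergeˡ true  u u′ v {F} _ = NearC-refl v F
  NearC-mergeˡ false u u′ v     h = h

  NearC-mergeʳ : ∀ {K} b (u : Coord (not b) K) v v′ {F} →
    NearC κ b v F v′ → NearC κ true (merge κ B b u v) F (merge κ B b u v′)
  NearC-mergeʳ true  u v v′     h = h
  NearC-mergeʳ false u v v′ {F} _ = NearC-refl u F

  Near-pairˡ : ∀ {F} (x x′ : X) (y : Y) →
    Near κ (outB κ B) x F x′ → Near κ (full κ) (pair κ B x y) F (pair κ B x′ y)
  Near-pairˡ x x′ y near l = NearC-mergeˡ (lookup B l) (x l) (x′ l) (y l) (near l)

  Near-pairʳ : ∀ {F} (x : X) (y y′ : Y) →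
    Near κ (inB κ B) y F y′ → Near κ (full κ) (pair κ B x y) F (pair κ B x y′)
  Near-pairʳ x y y′ near l = NearC-mergeʳ (lookup B l) (x l) (y l) (y′ l) (near l)

  slice-continuous : ∀ A C (h : Z → Bool) (x : X) →
    (∀ y → InD κ (inB κ B) C y → InD κ (full κ) A (pair κ B x y)) →
    Continuous κ (full κ) A h → Continuous κ (inB κ B) C (λ y → h (pair κ B x y))
  slice-continuous A C h x pair-x∈D h-cont y y∈D with h-cont (pair κ B x y) (pair-x∈D y y∈D)
  ... | F , near⇒≡ = F , λ y′ y′∈D near →
    near⇒≡ (pair κ B x y′) (pair-x∈D y′ y′∈D) (Near-pairʳ x y y′ near)

  currying-continuous : ∀ (h : Z → Bool) →
    Continuous κ (full κ) B h → ContinuousZ κ B (λ x y → h (pair κ B x y))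
  currying-continuous h h-cont x [] = (λ _ → []) , λ _ _ → []
  currying-continuous h h-cont x ((y , y∈D) ∷ S)
    with h-cont (pair κ B x y) (pair-InD B x y (λ _ l∈B → l∈B) y∈D) | currying-continuous h h-cont x S
  ... | F , near⇒≡ | G , near⇒all≡ = (λ i → F i ++ G i) , λ x′ near →
    near⇒≡ (pair κ B x′ y) (pair-InD B x′ y (λ _ l∈B → l∈B) y∈D)
      (Near-pairˡ x x′ y (Near-antitone x (λ i → xs⊆xs++ys (F i) (G i)) near))
    ∷ near⇒all≡ x′ (Near-antitone x (λ i → xs⊆ys++xs (G i) (F i)) near)

  cocycle⇒top-coboundary : ∀ {k} (f : Subset N → Z → Bool) →
    ∣ B ∣ ≡ suc k → IsCochain κ k f → IsCocycle κ k f →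
    ∀ (x : X) j → lookup B j ≡ false → IsFinite κ (outB κ B j) (x j) →
    TopCoboundary κ B (φ κ B f x)
  cocycle⇒top-coboundary {k} f ∣B∣≡1+k f-cochain f-cocycle x j j∉B xj-fin = g , g-continuous , φ≡⊕g
    where
    open ≡-Reasoning

    A′ : Subset N
    A′ = B [ j ]≔ true

    g : Fin N → Y → Bool
    g i y = f (A′ - i) (pair κ B x y)

    j∈A′ : lookup A′ j ≡ true
    j∈A′ = lookup∘update j B true

    A′-j≡B : A′ - j ≡ B
    A′-j≡B = x∉p⇒p[x]≔true-x≡p B j j∉B

    ∣A′∣≡2+k : ∣ A′ ∣ ≡ suc (suc k)
    ∣A′∣≡2+k = begin
      ∣ A′ ∣          ≡⟨ sym (x∈p⇒suc∣p-x∣≡∣p∣ A′ j j∈A′) ⟩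
      suc ∣ A′ - j ∣  ≡⟨ cong (suc ∘ ∣_∣) A′-j≡B ⟩
      suc ∣ B ∣       ≡⟨ cong suc ∣B∣≡1+k ⟩
      suc (suc k)     ∎

    x,y∈D[C∪j] : ∀ C y → (∀ l → lookup C l ≡ true → lookup B l ≡ true) →
      InD κ (inB κ B) C y → InD κ (full κ) (C [ j ]≔ true) (pair κ B x y)
    x,y∈D[C∪j] C y C⊆B y∈D =
      InD-insert C (pair κ B x y) j (merge-finiteˡ (lookup B j) (x j) (y j) j∉B xj-fin)
        (pair-InD C x y C⊆B y∈D)

    g-continuous : ∀ i → lookup B i ≡ true → Continuous κ (inB κ B) (B - i) (g i)
    g-continuous i i∈B =
      slice-continuous (A′ - i) (B - i) (f (A′ - i)) x x,y∈D[A′-i] (f-cochain (A′ - i) ∣A′-i∣≡1+k)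
      where
      i≢j : i ≢ j
      i≢j refl = contradiction (trans (sym i∈B) j∉B) λ ()

      ∣A′-i∣≡1+k : ∣ A′ - i ∣ ≡ suc k
      ∣A′-i∣≡1+k = suc-injective (trans (x∈p⇒suc∣p-x∣≡∣p∣ A′ i i∈A′) ∣A′∣≡2+k)
        where
        i∈A′ : lookup A′ i ≡ true
        i∈A′ = trans (lookup∘update′ i≢j B true) i∈B

      x,y∈D[A′-i] : ∀ y → InD κ (inB κ B) (B - i) y → InD κ (full κ) (A′ - i) (pair κ B x y)
      x,y∈D[A′-i] y y∈D =
        subst (λ A → InD κ (full κ) A (pair κ B x y)) (sym (p[y]≔true-x≡p-x[y]≔true B i≢j))
          (x,y∈D[C∪j] (B - i) y (p-x⊆p B i) y∈D)

    φ≡⊕g : ∀ y → InD κ (inB κ B) B y → φ κ B f x y ≡ ⊕[ B ] (λ i → g i y)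
    φ≡⊕g y y∈D = xor≡false⇒≡ (begin
      f B z xor ⊕[ B ] G               ≡⟨ cong (λ C → f C z xor ⊕[ C ] G) (sym A′-j≡B) ⟩
      G j xor ⊕[ A′ - j ] G            ≡⟨ sym (x∈p⇒⊕[p]≡g[x]xor⊕[p-x] A′ j G j∈A′) ⟩
      ⊕[ A′ ] G                        ≡⟨ f-cocycle A′ ∣A′∣≡2+k z x,y∈D[A′] ⟩
      false                            ∎)
      where
      z : Z
      z = pair κ B x y
      G : Fin N → Bool
      G i = f (A′ - i) z
      x,y∈D[A′] : InD κ (full κ) A′ z
      x,y∈D[A′] = x,y∈D[C∪j] B y (λ _ l∈B → l∈B) y∈D

proposition5p4 :
    (n : ℕ) (κ : Fin (suc n) → Set) →
    (∀ (i j : Fin (suc n)) → i Data.Fin.≤ j → κ i ↣ κ j) →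
    (k : ℕ) → k ≤ n →
    (B : Subset (suc n)) → ∣ B ∣ ≡ suc k →
    (f : Subset (suc n) → Pt κ (full κ) → Bool) →
    IsCochain κ k f → IsCocycle κ k f →
    ContinuousZ κ B (φ κ B f)
      × (∀ x → ¬ (∀ i → x i ≡ ∞pt κ (outB κ B) i) → TopCoboundary κ B (φ κ B f x))
proposition5p4 n κ _ k _ B ∣B∣≡1+k f f-cochain f-cocycle =
  currying-continuous (f B) (f-cochain B ∣B∣≡1+k) , λ x x≢∞ →
    let (j , j∉B , xj-fin) = finite-outside-coordinate x x≢∞
    in cocycle⇒top-coboundary f ∣B∣≡1+k f-cochain f-cocycle x j j∉B xj-fin
  where open Slices κ B
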